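{- Setup: - Let $G=(V,E)$ and $G'=(V',E')$ be graphs with disjoint vertex sets, and let $z\in V'$. - Let $\mathcal G=\langle G,h,g\rangle$ and $\mathcal G'=\langle G',h',g'\rangle$ be winning games. - Suppose there is a natural number $s$ such that for each $v\in V$ there are natural numbers $a_v,b'_v$ with $g(v)=sa_v$ and $h'(z)=sb'_v$. - Let $\widetilde G$ be the graph with vertex set $V\cup V'\setminus\{z\}$ and edge set $E\cup E(G'\setminus\{z\})\cup\{uw:u\in V,\ w\in N_{G'}(z)\}$. That is, $\widetilde G$ is obtained by substituting $G$ in place of $z$. - Let $(\widetilde h(u),\widetilde g(u))=(h'(u),g'(u))$ for $u\in V'\setminus\{z\}$, and $(\widetilde h(u),\widetilde g(u))=(h(u)b'_u,\,a_ug'(z))$ for $u\in V$. Conclusion: the game $\langle\widetilde G,\widetilde h,\widetilde g\rangle$ is winning.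
   Context: Hat guessing game $\langle G,h,g\rangle$: $G=(V,E)$ is a finite graph and $h,g\colon V\to\mathbb N$. The adversary gives each vertex $v$ a color in $\{0,\dots,h(v)-1\}$. Each vertex sees only its neighbors' colors and names at most $g(v)$ colors according to a deterministic strategy, fixed in advance, that depends only on those colors. The game is winning if some strategy ensures that for every assignment at least one vertex names its own color. $N_{G'}(z)$ denotes the neighborhood of $z$ in $G'$. -}

module Defs where

open import Data.Nat using (ℕ; suc; _*_; _≤_)
open import Data.Fin using (Fin; punchIn)
open import Data.Fin.Properties using (punchIn-injective)
open import Data.Sum using (_⊎_; inj₁; inj₂)
open import Data.Product using (Σ; ∃; _×_; _,_)
open import Data.List using (List; length)
open import Data.List.Membership.Propositional using (_∈_)
open import Relation.Nullary using (¬_)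
open import Relation.Binary.PropositionalEquality using (_≡_)

record Graph (V : Set) : Set₁ where
  field
    Adj   : V → V → Set
    sym   : ∀ {u v} → Adj u v → Adj v u
    irrefl : ∀ v → ¬ Adj v v
open Graph public

Coloring : {V : Set} → (V → ℕ) → Set
Coloring {V} h = (v : V) → Fin (h v)

record Strategy {V : Set} (G : Graph V) (h g : V → ℕ) : Set where
  field
    guess : (v : V) → Coloring h → List (Fin (h v))
    bound : ∀ v c → length (guess v c) ≤ g v
    local : ∀ v (c c′ : Coloring h) →
            (∀ u → Adj G v u → c u ≡ c′ u) → guess v c ≡ guess v c′
open Strategy public

Winning : {V : Set} → Graph V → (V → ℕ) → (V → ℕ) → Set
Winning G h g = Σ (Strategy G h g) λ S → ∀ (c : Coloring h) → ∃ λ v → c v ∈ guess S v c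

-- Substitution of G (on Fin n) in place of z in G′ (on Fin (suc m)).
-- The vertex set V ∪ V′∖{z} is Fin n ⊎ Fin m, where w : Fin m stands for punchIn z w ∈ V′∖{z}.
SubstAdj : ∀ {n m} → Graph (Fin n) → Graph (Fin (suc m)) → Fin (suc m) →
           Fin n ⊎ Fin m → Fin n ⊎ Fin m → Set
SubstAdj G G′ z (inj₁ u) (inj₁ u′) = Adj G u u′
SubstAdj G G′ z (inj₁ u) (inj₂ w)  = Adj G′ z (punchIn z w)
SubstAdj G G′ z (inj₂ w) (inj₁ u)  = Adj G′ z (punchIn z w)
SubstAdj G G′ z (inj₂ w) (inj₂ w′) = Adj G′ (punchIn z w) (punchIn z w′)

Subst : ∀ {n m} → Graph (Fin n) → Graph (Fin (suc m)) → Fin (suc m) → Graph (Fin n ⊎ Fin m)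
Subst G G′ z = record { Adj = SubstAdj G G′ z ; sym = λ {x} {y} → s {x} {y} ; irrefl = i }
  where
  s : ∀ {x y} → SubstAdj G G′ z x y → SubstAdj G G′ z y x
  s {inj₁ u} {inj₁ u′} p = sym G p
  s {inj₁ u} {inj₂ w}  p = p
  s {inj₂ w} {inj₁ u}  p = p
  s {inj₂ w} {inj₂ w′} p = sym G′ p
  i : ∀ x → ¬ SubstAdj G G′ z x x
  i (inj₁ u) = irrefl G u
  i (inj₂ w) = irrefl G′ (punchIn z w)

substH : ∀ {n m} → (Fin n → ℕ) → (Fin (suc m) → ℕ) → Fin (suc m) → (Fin n → ℕ) → Fin n ⊎ Fin m → ℕ
substH h h′ z b′ (inj₁ u) = h u * b′ u
substH h h′ z b′ (inj₂ w) = h′ (punchIn z w)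

substG : ∀ {n m} → (Fin n → ℕ) → (Fin (suc m) → ℕ) → Fin (suc m) → (Fin n → ℕ) → Fin n ⊎ Fin m → ℕ
substG g g′ z a (inj₁ u) = a u * g′ z
substG g g′ z a (inj₂ w) = g′ (punchIn z w)

-- A winning strategy on G with g v = s·a v guesses, split into s blocks of a v guesses, still wins
-- once every vertex is told which block contains the winner's correct guess; appending the
-- winner's colour modulo b′ to that block index gives a hint in Fin (s·b′) = Fin (h′ z). In the
-- substituted graph, z's neighbours see all of V and can therefore play G′ as if z wore this hint
-- as its colour, while every u ∈ V, seeing all of N(z), tries each of the g′ z colours z would
-- guess as the hint, which costs a u · g′ z guesses. If z would win, the hint is correct and some
-- u ∈ V wins; otherwise a vertex of V′ ∖ {z} wins.
module Submission where

open import Defs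
open import Data.Nat using (ℕ; suc; _*_)
open import Data.Fin using (Fin)
open import Data.Product using (_×_)
open import Relation.Binary.PropositionalEquality using (_≡_)

open import Data.Nat using (zero; _+_; _∸_; _≤_; z≤n)
open import Data.Nat.Properties
  using (≤-trans; ≤-reflexive; +-mono-≤; *-monoˡ-≤; *-comm; m⊓n≤m; ∸-monoˡ-≤; m+n∸m≡n; module ≤-Reasoning)
open import Data.Fin using (zero; suc; punchIn; combine; remQuot; cast)
open import Data.Fin.Properties using (remQuot-combine; combine-remQuot; cast-involutive)
open import Data.List using (List; []; _∷_; length; take; drop; map; concatMap)
open import Data.List.Properties using (length-take; length-drop; take++drop≡id; length-++; length-map; concatMap-cong)
open import Data.List.Membership.Propositional using (_∈_; lose)
open import Data.List.Membership.Propositional.Properties using (∈-++⁻; ∈-map⁺; ∈-concatMap⁺)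
open import Data.Product using (∃; _,_; proj₁; proj₂)
open import Data.Sum using (_⊎_; inj₁; inj₂)
open import Data.Unit using (⊤; tt)
open import Data.Empty using (⊥-elim)
open import Function using (_∘_)
open import Relation.Binary.PropositionalEquality
  using (refl; trans; cong; cong₂; subst; subst₂; module ≡-Reasoning)
  renaming (sym to ≡-sym)

private
  variable
    A : Set

chunk : (s a : ℕ) → List A → Fin s → List A
chunk (suc s) a xs zero    = take a xs
chunk (suc s) a xs (suc i) = chunk s a (drop a xs) i

length-chunk : ∀ s a (xs : List A) i → length (chunk s a xs i) ≤ a
length-chunk (suc s) a xs zero    = ≤-trans (≤-reflexive (length-take a xs)) (m⊓n≤m a _)
length-chunk (suc s) a xs (suc i) = length-chunk s a (drop a xs) i

∈-chunk : ∀ s a {xs : List A} {x} → length xs ≤ s * a → x ∈ xs → ∃ λ i → x ∈ chunk s a xs i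
∈-chunk zero    a {[]}    _  ()
∈-chunk (suc s) a {xs} {x} len x∈xs
  with ∈-++⁻ (take a xs) (subst (x ∈_) (≡-sym (take++drop≡id a xs)) x∈xs)
... | inj₁ x∈take = zero , x∈take
... | inj₂ x∈drop = let i , x∈chunk = ∈-chunk s a len′ x∈drop in suc i , x∈chunk
  where
  open ≤-Reasoning
  len′ : length (drop a xs) ≤ s * a
  len′ = begin
    length (drop a xs) ≡⟨ length-drop a xs ⟩
    length xs ∸ a      ≤⟨ ∸-monoˡ-≤ a len ⟩
    a + s * a ∸ a      ≡⟨ m+n∸m≡n a (s * a) ⟩
    s * a              ∎

length-concatMap-≤ : ∀ {B : Set} {a} (f : A → List B) → (∀ x → length (f x) ≤ a) →
                     ∀ xs → length (concatMap f xs) ≤ length xs * a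
length-concatMap-≤ f bound []       = z≤n
length-concatMap-≤ f bound (x ∷ xs) =
  ≤-trans (≤-reflexive (length-++ (f x))) (+-mono-≤ (bound x) (length-concatMap-≤ f bound xs))

-- Without function extensionality, a function of a colouring (such as the hint below) need not
-- respect pointwise equality; precomposing it with canonical makes it do so.
module _ {n} {P : Fin n → Set} where

  private
    Tuple : ∀ {n} → (Fin n → Set) → Set
    Tuple {zero}  P = ⊤
    Tuple {suc n} P = P zero × Tuple (P ∘ suc)

    toTuple : ∀ {n} {P : Fin n → Set} → ((v : Fin n) → P v) → Tuple P
    toTuple {zero}  f = tt
    toTuple {suc n} f = f zero , toTuple (f ∘ suc)

    fromTuple : ∀ {n} {P : Fin n → Set} → Tuple P → (v : Fin n) → P v
    fromTuple (x , t) zero    = x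
    fromTuple (x , t) (suc v) = fromTuple t v

    fromTuple-toTuple : ∀ {n} {P : Fin n → Set} (f : (v : Fin n) → P v) v → fromTuple (toTuple f) v ≡ f v
    fromTuple-toTuple f zero    = refl
    fromTuple-toTuple f (suc v) = fromTuple-toTuple (f ∘ suc) v

    toTuple-cong : ∀ {n} {P : Fin n → Set} {f f′ : (v : Fin n) → P v} → (∀ v → f v ≡ f′ v) →
                   toTuple f ≡ toTuple f′
    toTuple-cong {zero}  eq = refl
    toTuple-cong {suc n} eq = cong₂ _,_ (eq zero) (toTuple-cong (eq ∘ suc))

  canonical : ((v : Fin n) → P v) → (v : Fin n) → P v
  canonical = fromTuple ∘ toTuple

  canonical-≗ : ∀ f v → canonical f v ≡ f v
  canonical-≗ = fromTuple-toTuple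

  canonical-cong : ∀ {f f′} → (∀ v → f v ≡ f′ v) → canonical f ≡ canonical f′
  canonical-cong = cong fromTuple ∘ toTuple-cong

-- Also serves as the eliminator for Fin (suc m) = {z} ∪ punchIn z (Fin m).
insertAt : ∀ {m} {P : Fin (suc m) → Set} (z : Fin (suc m)) →
           P z → ((w : Fin m) → P (punchIn z w)) → (v : Fin (suc m)) → P v
insertAt          zero    x f zero    = x
insertAt          zero    x f (suc v) = f v
insertAt {suc m} (suc z) x f zero    = f zero
insertAt {suc m} (suc z) x f (suc v) = insertAt z x (f ∘ suc) v

insertAt-lookup : ∀ {m} {P : Fin (suc m) → Set} (z : Fin (suc m)) x (f : (w : Fin m) → P (punchIn z w)) →
                  insertAt {P = P} z x f z ≡ x
insertAt-lookup          zero    x f = refl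
insertAt-lookup {suc m} (suc z) x f = insertAt-lookup z x (f ∘ suc)

insertAt-punchIn : ∀ {m} {P : Fin (suc m) → Set} (z : Fin (suc m)) x (f : (w : Fin m) → P (punchIn z w)) w →
                   insertAt {P = P} z x f (punchIn z w) ≡ f w
insertAt-punchIn          zero    x f w       = refl
insertAt-punchIn {suc m} (suc z) x f zero    = refl
insertAt-punchIn {suc m} (suc z) x f (suc w) = insertAt-punchIn z x (f ∘ suc) w

record WinningWithHint {V : Set} (G : Graph V) (h g : V → ℕ) (H : ℕ) : Set where
  field
    hint            : Coloring h → Fin H
    guessWith       : (v : V) → Coloring h → Fin H → List (Fin (h v))
    guessWith-bound : ∀ v c i → length (guessWith v c i) ≤ g v
    guessWith-local : ∀ v (c c′ : Coloring h) i →
                      (∀ u → Adj G v u → c u ≡ c′ u) → guessWith v c i ≡ guessWith v c′ i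
    hint-wins       : ∀ c → ∃ λ v → c v ∈ guessWith v c (hint c)
open WinningWithHint

winning⇒winningWithHint : ∀ {V} {G : Graph V} {h g : V → ℕ} {s} {a : V → ℕ} →
                          Winning G h g → (∀ v → g v ≡ s * a v) → WinningWithHint G h a s
winning⇒winningWithHint {s = s} {a} (S , wins) g≡s*a = record
  { hint            = proj₁ ∘ block
  ; guessWith       = λ v c → chunk s (a v) (guess S v c)
  ; guessWith-bound = λ v c → length-chunk s (a v) (guess S v c)
  ; guessWith-local = λ v c c′ i agree → cong (λ xs → chunk s (a v) xs i) (local S v c c′ agree)
  ; hint-wins       = λ c → proj₁ (wins c) , proj₂ (block c)
  }
  where
  block : ∀ c → let v = proj₁ (wins c) in ∃ λ i → c v ∈ chunk s (a v) (guess S v c) i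
  block c = let v , c∈guess = wins c in
            ∈-chunk s (a v) (subst (length (guess S v c) ≤_) (g≡s*a v) (bound S v c)) c∈guess

winningWithHint-scale : ∀ {V} {G : Graph V} {h g b : V → ℕ} {s H} →
                        WinningWithHint G h g s → (∀ v → H ≡ s * b v) →
                        WinningWithHint G (λ v → h v * b v) g H
winningWithHint-scale {V} {h = h} {b = b} {s} {H} W H≡s*b = record
  { hint            = hint′
  ; guessWith       = guessWith′
  ; guessWith-bound = λ v c l → ≤-trans (≤-reflexive (length-map _ (guessWith W v (high c) _)))
                                        (guessWith-bound W v (high c) _)
  ; guessWith-local = λ v c c′ l agree →
      cong (map _) (guessWith-local W v (high c) (high c′) _ (λ u adj → cong (proj₁ ∘ remQuot {h u} (b u)) (agree u adj)))
  ; hint-wins       = wins′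
  }
  where
  high : Coloring (λ v → h v * b v) → Coloring h
  high c v = proj₁ (remQuot {h v} (b v) (c v))

  low : ∀ (c : Coloring (λ v → h v * b v)) v → Fin (b v)
  low c v = proj₂ (remQuot {h v} (b v) (c v))

  encode : ∀ v → Fin s → Fin (b v) → Fin H
  encode v i j = cast (≡-sym (H≡s*b v)) (combine i j)

  decode : ∀ v → Fin H → Fin s × Fin (b v)
  decode v l = remQuot {s} (b v) (cast (H≡s*b v) l)

  decode-encode : ∀ v i j → decode v (encode v i j) ≡ (i , j)
  decode-encode v i j = trans (cong (remQuot (b v)) (cast-involutive (H≡s*b v) (≡-sym (H≡s*b v)) _))
                              (remQuot-combine i j)

  hint′ : Coloring (λ v → h v * b v) → Fin H
  hint′ c = let v = proj₁ (hint-wins W (high c)) in encode v (hint W (high c)) (low c v)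

  guessWith′ : ∀ v → Coloring (λ v → h v * b v) → Fin H → List (Fin (h v * b v))
  guessWith′ v c l = let i , j = decode v l in map (λ x → combine x j) (guessWith W v (high c) i)

  wins′ : ∀ c → ∃ λ v → c v ∈ guessWith′ v c (hint′ c)
  wins′ c = v , subst₂ _∈_ (combine-remQuot {h v} (b v) (c v)) (≡-sym guessWith′≡) (∈-map⁺ _ high∈guess)
    where
    v : V
    v = proj₁ (hint-wins W (high c))
    high∈guess : high c v ∈ guessWith W v (high c) (hint W (high c))
    high∈guess = proj₂ (hint-wins W (high c))
    guessWith′≡ : guessWith′ v c (hint′ c) ≡ map (λ x → combine x (low c v)) (guessWith W v (high c) (hint W (high c)))
    guessWith′≡ = cong (λ (i , j) → map (λ x → combine x j) (guessWith W v (high c) i))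
                       (decode-encode v (hint W (high c)) (low c v))

module _ {n m} (G : Graph (Fin n)) (G′ : Graph (Fin (suc m))) (z : Fin (suc m))
         (h g : Fin n → ℕ) (h′ g′ : Fin (suc m) → ℕ) (a b′ : Fin n → ℕ)
         (W : WinningWithHint G (λ u → h u * b′ u) a (h′ z)) (W′ : Winning G′ h′ g′) where

  private
    G̃ : Graph (Fin n ⊎ Fin m)
    G̃ = Subst G G′ z
    h̃ : Fin n ⊎ Fin m → ℕ
    h̃ = substH h h′ z b′
    S′ : Strategy G′ h′ g′
    S′ = proj₁ W′

    inV : Coloring h̃ → Coloring (λ u → h u * b′ u)
    inV c u = c (inj₁ u)

    colourOfZ : Coloring h̃ → Fin (h′ z)
    colourOfZ c = hint W (canonical (inV c))

    colouringOfG′ : Coloring h̃ → Coloring h′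
    colouringOfG′ c = insertAt z (colourOfZ c) (c ∘ inj₂)

    guessesOfZ : Coloring h̃ → List (Fin (h′ z))
    guessesOfZ c = guess S′ z (colouringOfG′ c)

    guess̃ : ∀ v → Coloring h̃ → List (Fin (h̃ v))
    guess̃ (inj₁ u) c = concatMap (guessWith W u (inV c)) (guessesOfZ c)
    guess̃ (inj₂ w) c = guess S′ (punchIn z w) (colouringOfG′ c)

    bound̃ : ∀ v c → length (guess̃ v c) ≤ substG g g′ z a v
    bound̃ (inj₁ u) c = begin
      length (guess̃ (inj₁ u) c) ≤⟨ length-concatMap-≤ _ (guessWith-bound W u (inV c)) (guessesOfZ c) ⟩
      length (guessesOfZ c) * a u ≤⟨ *-monoˡ-≤ (a u) (bound S′ z (colouringOfG′ c)) ⟩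
      g′ z * a u                  ≡⟨ *-comm (g′ z) (a u) ⟩
      a u * g′ z                  ∎
      where open ≤-Reasoning
    bound̃ (inj₂ w) c = bound S′ (punchIn z w) (colouringOfG′ c)

    colouringOfG′-agrees : ∀ (c c′ : Coloring h̃) x →
      (Adj G′ x z → ∀ u → c (inj₁ u) ≡ c′ (inj₁ u)) → (∀ w → Adj G′ x (punchIn z w) → c (inj₂ w) ≡ c′ (inj₂ w)) →
      ∀ v → Adj G′ x v → colouringOfG′ c v ≡ colouringOfG′ c′ v
    colouringOfG′-agrees c c′ x agreeV agreeW =
      insertAt z (λ adj → begin
                   colouringOfG′ c z  ≡⟨ insertAt-lookup z _ _ ⟩
                   colourOfZ c        ≡⟨ cong (hint W) (canonical-cong (agreeV adj)) ⟩
                   colourOfZ c′       ≡⟨ insertAt-lookup z _ _ ⟨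
                   colouringOfG′ c′ z ∎)
                 (λ w adj → begin
                   colouringOfG′ c (punchIn z w)  ≡⟨ insertAt-punchIn z _ _ w ⟩
                   c (inj₂ w)                     ≡⟨ agreeW w adj ⟩
                   c′ (inj₂ w)                    ≡⟨ insertAt-punchIn z _ _ w ⟨
                   colouringOfG′ c′ (punchIn z w) ∎)
      where open ≡-Reasoning

    local̃ : ∀ v (c c′ : Coloring h̃) → (∀ y → Adj G̃ v y → c y ≡ c′ y) → guess̃ v c ≡ guess̃ v c′
    local̃ (inj₁ u) c c′ agree = trans
      (concatMap-cong (λ l → guessWith-local W u (inV c) (inV c′) l (agree ∘ inj₁)) (guessesOfZ c))
      (cong (concatMap _) (local S′ z _ _ (colouringOfG′-agrees c c′ z
        (λ z∼z → ⊥-elim (irrefl G′ z z∼z)) (agree ∘ inj₂))))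
    local̃ (inj₂ w) c c′ agree = local S′ (punchIn z w) _ _ (colouringOfG′-agrees c c′ (punchIn z w)
      (λ adj u → agree (inj₁ u) (sym G′ adj)) (agree ∘ inj₂))

    winsAtZ : ∀ c → colourOfZ c ∈ guessesOfZ c → ∃ λ v → c v ∈ guess̃ v c
    winsAtZ c hint∈guesses = inj₁ u , ∈-concatMap⁺ _ (lose hint∈guesses c∈guessWith)
      where
      ĉ : Coloring (λ u → h u * b′ u)
      ĉ = canonical (inV c)
      u : Fin n
      u = proj₁ (hint-wins W ĉ)
      c∈guessWith : c (inj₁ u) ∈ guessWith W u (inV c) (colourOfZ c)
      c∈guessWith = subst₂ _∈_ (canonical-≗ (inV c) u)
        (guessWith-local W u ĉ (inV c) _ (λ u′ _ → canonical-≗ (inV c) u′)) (proj₂ (hint-wins W ĉ))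

    wins̃ : ∀ c → ∃ λ v → c v ∈ guess̃ v c
    wins̃ c = insertAt {P = λ v → c′ v ∈ guess S′ v c′ → ∃ λ v → c v ∈ guess̃ v c} z
      (winsAtZ c ∘ subst (_∈ guessesOfZ c) (insertAt-lookup z _ _))
      (λ w → (inj₂ w ,_) ∘ subst (_∈ guess̃ (inj₂ w) c) (insertAt-punchIn z _ _ w))
      (proj₁ (proj₂ W′ c′)) (proj₂ (proj₂ W′ c′))
      where
      c′ : Coloring h′
      c′ = colouringOfG′ c

  substitution-winning : Winning G̃ h̃ (substG g g′ z a)
  substitution-winning = record { guess = guess̃ ; bound = bound̃ ; local = local̃ } , wins̃

corollary2p5 : ∀ {n m} (G : Graph (Fin n)) (G′ : Graph (Fin (suc m))) (z : Fin (suc m))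
                 (h g : Fin n → ℕ) (h′ g′ : Fin (suc m) → ℕ) →
                 Winning G h g → Winning G′ h′ g′ →
                 (s : ℕ) (a b′ : Fin n → ℕ) →
                 (∀ v → g v ≡ s * a v × h′ z ≡ s * b′ v) →
                 Winning (Subst G G′ z) (substH h h′ z b′) (substG g g′ z a)
corollary2p5 G G′ z h g h′ g′ W W′ s a b′ eqs =
  substitution-winning G G′ z h g h′ g′ a b′ hinted W′
  where
  hinted : WinningWithHint G (λ u → h u * b′ u) a (h′ z)
  hinted = winningWithHint-scale (winning⇒winningWithHint {s = s} {a} W (proj₁ ∘ eqs)) (proj₂ ∘ eqs)
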